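{- Let $\mathbf A$ be an enumerated $\mathcal L$-structure with $\mathrm{Age}(\mathbf A)\subseteq\mathcal K$, let $1\le m\le|\mathbf A|$ with $m<\omega$, and let $f\in\mathrm{AEmb}(\mathrm{ct}^{\mathbf A}|_m,\mathrm{ct})$. Then $f':(T(m),\mathcal C^{\mathbf A}(m))\to T(\tilde f(m-1)+1)$ is an age map (the target carrying the class $\mathcal C(\tilde f(m-1)+1)$).
   Context: Conventions. $\mathcal L=\{U_0,\dots,U_{k-1};R_0,\dots,R_{k-1}\}$ is a finite relational language, $U_i$ unary, $R_i$ binary, and all $\mathcal L$-structures $\mathbf A$ satisfy: every $R_i^{\mathbf A}$ is irreflexive; $\mathbf A=\bigsqcup_{i<k}U_i^{\mathbf A}$; $\mathbf A^2\setminus\{(a,a):a\in\mathbf A\}=\bigsqcup_{i<k}R_i^{\mathbf A}$; and there is $\mathrm{Flip}:k\to k$ with $\mathrm{Flip}^2=\mathrm{id}$, $\mathrm{Flip}(0)=0$, such that $R^{\mathbf A}(a,b)=i$ iff $R^{\mathbf A}(b,a)=\mathrm{Flip}(i)$. Here $U^{\mathbf A}(a)=i$ means $U_i^{\mathbf A}(a)$ and $R^{\mathbf A}(a,b)=i$ means $R_i^{\mathbf A}(a,b)$; $R_0$ plays the role of "no relation". $\mathcal K$ is a Fraïssé class of finite $\mathcal L$-structures with free amalgamation: any embeddings $f:\mathbf A\to\mathbf B$, $g:\mathbf A\to\mathbf C$ in $\mathcal K$ can be amalgamated by embeddings $r:\mathbf B\to\mathbf D$, $s:\mathbf C\to\mathbf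 D$ with $\mathbf D\in\mathcal K$, $r\circ f=s\circ g$, $\mathbf D=\mathrm{im}(r)\cup\mathrm{im}(s)$, $\mathrm{im}(r)\cap\mathrm{im}(s)=\mathrm{im}(r\circ f)$, and $R^{\mathbf D}(a,b)=0$ unless $\{a,b\}\subseteq\mathrm{im}(r)$ or $\{a,b\}\subseteq\mathrm{im}(s)$. An enumerated structure is one whose underlying set is the cardinal $|\mathbf A|\le\omega$; for $m\le|\mathbf A|$, $\mathbf A_m$ is the induced substructure on $m=\{0,\dots,m-1\}$. $\mathbf K$ is a Fraïssé limit of $\mathcal K$ with underlying set $\omega$ which is left dense: for every $m<\omega$ and every $\mathbf A\in\mathcal K$ with underlying set $m+1$ and $\mathbf A_m=\mathbf K_m$ there is $n\ge m$ such that the map $i\mapsto i$ ($i<m$), $m\mapsto n$ is an embedding $\mathbf A\to\mathbf K$ and $R^{\mathbf K}(r,n)=0$ for all $m\le r<n$. Write $U=U^{\mathbf K}$, $R=R^{\mathbf K}$. $\mathrm{Age}(\mathbf A)$ is the class of finite structures embeddable in $\mathbf A$. Trees. $T=k^{<\omega}$, $T(n)=k^n$, with $T(<n),T(\le n),T(\ge n)$ as usual; $\ell(s)$ is the length of $s$; $s\sqsubseteq t$ means $t$ extends $s$; $s\wedge t$ is the longest common initial segment; $s^\frown i$ appends $i<k$; $\mathrm{Left}(s,n)$ is the extension of $s$ to length $n\ge\ell(s)$ by zeros; $\pi_m:T(\ge m)\to T(m)$ is restriction. Coding trees. For enumerated $\mathbf A$, $\mathrm{ct}^{\mathbf A}=(c^{\mathbf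 A},u^{\mathbf A})$ where $c^{\mathbf A}(j)\in T(j)$ is given by $c^{\mathbf A}(j)(i)=R^{\mathbf A}(i,j)$ for $i<j<|\mathbf A|$, and $u^{\mathbf A}(j)=U^{\mathbf A}(j)$; $\mathrm{ct}^{\mathbf A}|_m$ is the restriction to domain $m$. Write $\mathrm{ct}=(c,u)=\mathrm{ct}^{\mathbf K}$. Labeled structures. For a finite set $X$, an $X$-labeled structure is a finite $\mathcal L$-structure $\mathbf B$ with a map $\phi:\mathbf B\to X$. For enumerated $\mathbf A$, $m\le|\mathbf A|$, $m<\omega$, and a $T(m)$-labeled $(\mathbf B,\phi)$ with $\mathbf B\cap\omega=\emptyset$, $\mathbf B[\phi,\mathbf A]$ is the $\mathcal L$-structure on $\mathbf B\cup\mathbf A_m$ with $\mathbf B$ and $\mathbf A_m$ as induced substructures and $R(i,b)=\phi(b)(i)$ for $i<m$, $b\in\mathbf B$. If $\mathrm{Age}(\mathbf A)\subseteq\mathcal K$, $\mathcal C^{\mathbf A}(m)$ is the class of $T(m)$-labeled $(\mathbf B,\phi)$ with $\mathbf B[\phi,\mathbf A]\in\mathcal K$; $\mathcal C(m)=\mathcal C^{\mathbf K}(m)$. Given finite sets $X,Y$ with classes $\mathcal C_X,\mathcal C_Y$ of $X$- resp. $Y$-labeled structures, an age map is an injection $f:X\to Y$ such that for every $X$-labeled $(\mathbf B,\phi)$: $(\mathbf B,\phi)\in\mathcal C_X$ iff $(\mathbf B,f\circ\phi)\in\mathcal C_Y$. Unless stated otherwise, $T(m)$ and any $X\subseteq T(m)$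 carry the class $\mathcal C(m)$ (restricted to $X$-labeled structures); non-injective maps are never age maps. Embeddings. Let $\mathbf A$ be enumerated with $\mathrm{Age}(\mathbf A)\subseteq\mathcal K$ and $m\le|\mathbf A|$. A map $f:T(<m)\to T$ is an embedding of $\mathrm{ct}^{\mathbf A}|_m$ into $\mathrm{ct}$ if (1) $f$ is injective; (2) there is an increasing $\tilde f:m\to\omega$ with $f[T(j)]\subseteq T(\tilde f(j))$ for $j<m$; (3) $f(s\wedge t)=f(s)\wedge f(t)$; (4) $f(s^\frown i)\sqsupseteq f(s)^\frown i$ whenever $s^\frown i\in T(<m)$; (5) $f(c^{\mathbf A}(j))=c(\tilde f(j))$ and $u^{\mathbf A}(j)=u(\tilde f(j))$ for $j<m$. It is an aged embedding if moreover for each $j<m$, $f|_{T(j)}:(T(j),\mathcal C^{\mathbf A}(j))\to(T(\tilde f(j)),\mathcal C(\tilde f(j)))$ is an age map. $\mathrm{AEmb}(\mathrm{ct}^{\mathbf A}|_m,\mathrm{ct})$ is the set of these. For $S\subseteq T$ and $f:S\to T$, $f':\{s^\frown i:s\in S,i<k\}\to T$ is defined by $f'(s^\frown i)=f(s)^\frown i$. -}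

module Defs where

open import Data.Nat using (ℕ; zero; suc; _<_; _≤_; _<ᵇ_)
open import Data.Bool using (if_then_else_)
open import Data.Fin using (Fin; zero; suc; toℕ; splitAt; inject₁; _≟_)
open import Data.Sum using (_⊎_; inj₁; inj₂)
open import Data.Product using (Σ; _×_; _,_; proj₁; ∃; Σ-syntax)
open import Data.Unit using (⊤)
open import Data.List using (List; []; _∷_; _++_; map; upTo; length; _∷ʳ_)
open import Data.Vec using (Vec; lookup; toList; fromList; cast; init; last)
  renaming (_∷ʳ_ to _∷ʳᵥ_)
open import Function using (_∘_)
open import Function.Definitions using (Injective; Surjective)
open import Relation.Binary.PropositionalEquality using (_≡_; _≢_)
open import Relation.Nullary using (¬_; yes; no)

-- The language L = {U_0..U_{k-1}; R_0..R_{k-1}} together with Flip.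
-- Since Flip(0)=0 we need 0 < k; we write k = suc kpred.
record Lang : Set where
  field
    kpred   : ℕ
    Flip    : Fin (suc kpred) → Fin (suc kpred)
    Flip-inv : ∀ i → Flip (Flip i) ≡ i
    Flip-0  : Flip zero ≡ zero

data Card : Set where
  fin   : ℕ → Card
  omega : Card

_<ᶜ_ : ℕ → Card → Set
n <ᶜ fin N = n < N
n <ᶜ omega = ⊤

_≤ᶜ_ : ℕ → Card → Set
n ≤ᶜ fin N = n ≤ N
n ≤ᶜ omega = ⊤

module WithLang (L : Lang) where
  open Lang L

  Sym : Set
  Sym = Fin (suc kpred)

  -- An L-structure on carrier S: U(a) = i means U_i(a); R(a,b) = i means R_i(a,b)
  -- for a ≠ b.  The value R(a,a) is meaningless and ignored everywhere
  -- (this encodes irreflexivity and the partition conventions).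
  record Str (S : Set) : Set where
    field
      U : S → Sym
      R : S → S → Sym
  open Str public

  IsLStr : {S : Set} → Str S → Set
  IsLStr {S} A = ∀ (a b : S) → a ≢ b → R A b a ≡ Flip (R A a b)

  Emb : {S S' : Set} → Str S → Str S' → (S → S') → Set
  Emb {S} A B h = Injective _≡_ _≡_ h
                × (∀ a → U B (h a) ≡ U A a)
                × (∀ a b → a ≢ b → R B (h a) (h b) ≡ R A a b)

  pull : {S S' : Set} → (S' → S) → Str S → Str S'
  pull h A = record { U = U A ∘ h ; R = λ a b → R A (h a) (h b) }

  FinStr : ℕ → Set
  FinStr n = Str (Fin n)

  FinClass : Set₁
  FinClass = ∀ {n} → FinStr n → Set

  InIm : {S S' : Set} → (S → S') → S' → Set
  InIm {S} h z = Σ S λ y → h y ≡ z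

  record IsFreeFraisse (𝒦 : FinClass) : Set₁ where
    field
      lstr       : ∀ {n} (A : FinStr n) → 𝒦 A → IsLStr A
      nonempty   : Σ ℕ λ n → Σ (FinStr n) λ A → 𝒦 A
      -- hereditary and closed under isomorphism
      hereditary : ∀ {n n'} (A : FinStr n) (B : FinStr n') (h : Fin n → Fin n') →
                   IsLStr A → Emb A B h → 𝒦 B → 𝒦 A
      jep        : ∀ {a b} (A : FinStr a) (B : FinStr b) → 𝒦 A → 𝒦 B →
                   Σ ℕ λ d → Σ (FinStr d) λ D → Σ (Fin a → Fin d) λ r → Σ (Fin b → Fin d) λ s →
                   𝒦 D × Emb A D r × Emb B D s
      freeAmalg  : ∀ {a b c} (A : FinStr a) (B : FinStr b) (C : FinStr c)
                   (f : Fin a → Fin b) (g : Fin a → Fin c) →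
                   𝒦 A → 𝒦 B → 𝒦 C → Emb A B f → Emb A C g →
                   Σ ℕ λ d → Σ (FinStr d) λ D → Σ (Fin b → Fin d) λ r → Σ (Fin c → Fin d) λ s →
                     𝒦 D × Emb B D r × Emb C D s
                   × (∀ x → r (f x) ≡ s (g x))
                   × (∀ z → InIm r z ⊎ InIm s z)
                   × (∀ z → InIm r z → InIm s z → InIm (r ∘ f) z)
                   × (∀ z z' → z ≢ z' → ¬ (InIm r z × InIm r z') → ¬ (InIm s z × InIm s z') →
                        R D z z' ≡ zero)

  record IsFraisseLimit (𝒦 : FinClass) (K : Str ℕ) : Set₁ where
    field
      lstr  : IsLStr K
      age   : ∀ {n} (B : FinStr n) → IsLStr B →
              (𝒦 B → Σ (Fin n → ℕ) λ h → Emb B K h) × (Σ (Fin n → ℕ) (λ h → Emb B K h) → 𝒦 B)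
      ultrahom : ∀ {n} (e₁ e₂ : Fin n → ℕ) → Injective _≡_ _≡_ e₁ → Injective _≡_ _≡_ e₂ →
              (∀ i → U K (e₁ i) ≡ U K (e₂ i)) →
              (∀ i j → i ≢ j → R K (e₁ i) (e₁ j) ≡ R K (e₂ i) (e₂ j)) →
              Σ (ℕ → ℕ) λ σ → Emb K K σ × Surjective _≡_ _≡_ σ × (∀ i → σ (e₁ i) ≡ e₂ i)

  ext : (m n : ℕ) → Fin (suc m) → ℕ
  ext m n i = if toℕ i <ᵇ m then toℕ i else n

  LeftDense : FinClass → Str ℕ → Set
  LeftDense 𝒦 K = ∀ (m : ℕ) (A : FinStr (suc m)) → IsLStr A → 𝒦 A →
    (∀ (i : Fin m) → U A (inject₁ i) ≡ U K (toℕ i)) →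
    (∀ (i j : Fin m) → i ≢ j → R A (inject₁ i) (inject₁ j) ≡ R K (toℕ i) (toℕ j)) →
    Σ ℕ λ n → m ≤ n × Emb A K (ext m n) × (∀ r → m ≤ r → r < n → R K r n ≡ zero)

  -- enumerated structures: underlying set |A| ≤ ω; the functions U, R are on ℕ
  -- but only their values on the domain {i : i <ᶜ card} are meaningful.
  record EnumStr : Set where
    field
      card : Card
      str  : Str ℕ
  open EnumStr public

  Dom : Card → Set
  Dom c = Σ ℕ λ i → i <ᶜ c

  asStr : (A : EnumStr) → Str (Dom (card A))
  asStr A = pull proj₁ (str A)

  AgeSub : FinClass → EnumStr → Set
  AgeSub 𝒦 A = ∀ {n} (B : FinStr n) (h : Fin n → Dom (card A)) →
               IsLStr B → Emb B (asStr A) h → 𝒦 B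

  -- T = k^{<ω} as lists; T(n) ≅ Vec Sym n
  T : Set
  T = List Sym

  _⊑_ : T → T → Set
  s ⊑ t = Σ T λ u → s ++ u ≡ t

  meet : T → T → T
  meet [] _ = []
  meet (_ ∷ _) [] = []
  meet (x ∷ xs) (y ∷ ys) with x ≟ y
  ... | yes _ = x ∷ meet xs ys
  ... | no _  = []

  ctc : Str ℕ → ℕ → T
  ctc A j = map (λ i → R A i j) (upTo j)

  ctu : Str ℕ → ℕ → Sym
  ctu A j = U A j

  LClass : Set → Set₁
  LClass X = ∀ {n} → FinStr n → (Fin n → X) → Set

  glue : Str ℕ → (m : ℕ) → ∀ {n} → FinStr n → (Fin n → Vec Sym m) → Str (Fin m ⊎ Fin n)
  glue A m B φ = record { U = u' ; R = r' }
    where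
    u' : _ → Sym
    u' (inj₁ i) = U A (toℕ i)
    u' (inj₂ b) = U B b
    r' : _ → _ → Sym
    r' (inj₁ i) (inj₁ j) = R A (toℕ i) (toℕ j)
    r' (inj₂ a) (inj₂ b) = R B a b
    r' (inj₁ i) (inj₂ b) = lookup (φ b) i
    r' (inj₂ b) (inj₁ i) = Flip (lookup (φ b) i)

  glueFin : Str ℕ → (m : ℕ) → ∀ {n} → FinStr n → (Fin n → Vec Sym m) → FinStr (m Data.Nat.+ n)
  glueFin A m B φ = pull (splitAt m) (glue A m B φ)

  𝒞 : FinClass → Str ℕ → (m : ℕ) → LClass (Vec Sym m)
  𝒞 𝒦 A m B φ = 𝒦 (glueFin A m B φ)

  AgeMap : {X Y : Set} → LClass X → LClass Y → (X → Y) → Set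
  AgeMap {X} {Y} CX CY g = Injective _≡_ _≡_ g ×
    (∀ {n} (B : FinStr n) (φ : Fin n → X) → IsLStr B → (CX B φ → CY B (g ∘ φ)) × (CY B (g ∘ φ) → CX B φ))

  restrictLevel : (f : T → T) (j N : ℕ) → (∀ (v : Vec Sym j) → length (f (toList v)) ≡ N) →
                  Vec Sym j → Vec Sym N
  restrictLevel f j N lev v = cast (lev v) (fromList (f (toList v)))

  f'Level : (f : T → T) (p N : ℕ) → (∀ (v : Vec Sym p) → length (f (toList v)) ≡ N) →
            Vec Sym (suc p) → Vec Sym (suc N)
  f'Level f p N lev v = restrictLevel f p N lev (init v) ∷ʳᵥ last v

  record IsAEmb (𝒦 : FinClass) (A K : Str ℕ) (m : ℕ) (f : T → T) (f̃ : ℕ → ℕ) : Set₁ where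
    field
      inj   : ∀ s t → length s < m → length t < m → f s ≡ f t → s ≡ t
      incr  : ∀ i j → i < j → j < m → f̃ i < f̃ j
      level : ∀ j → j < m → ∀ (v : Vec Sym j) → length (f (toList v)) ≡ f̃ j
      meetp : ∀ s t → length s < m → length t < m → f (meet s t) ≡ meet (f s) (f t)
      succp : ∀ s i → length (s ∷ʳ i) < m → (f s ∷ʳ i) ⊑ f (s ∷ʳ i)
      codec : ∀ j → j < m → f (ctc A j) ≡ ctc K (f̃ j)
      codeu : ∀ j → j < m → ctu A j ≡ ctu K (f̃ j)
      aged  : ∀ j → (j<m : j < m) →
              AgeMap (𝒞 𝒦 A j) (𝒞 𝒦 K (f̃ j)) (restrictLevel f j (f̃ j) (level j j<m))

-- A T(M+1)-labelled structure (B, χ) glued onto S_(M+1) is the same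
-- L-structure as a T(M)-labelled structure glued onto S_M: the vertex M of S
-- is moved over to the labelled side.  Precisely, let B' be B plus one new
-- point * of colour U(M), related to b ∈ B by the last letter of χ(b), and
-- label * by the code c^S(M) and b by the first M letters of χ(b).  Then
--     B[χ, S] ≅ B'[ψ, S]   ('shift-Iso'),   so   𝒞^S(M+1) ∋ (B, χ) ⇔ 𝒞^S(M) ∋ (B', ψ).
-- Applying this to S = A at M = p and to S = K at M = f̃(p) (which share B',
-- because f maps the code c^A(p) to c(f̃ p) and u^A(p) = u(f̃ p)), the age-map
-- property of f at level p transfers to f' at level p+1.
--
-- Of the
-- hypotheses on K only the Flip convention is used.

module Submission where

open import Defs
open import Data.Nat using (ℕ; suc; _<_; pred)
open import Data.Nat.Properties using (n<1+n; <-≤-trans; m<n⇒m<1+n; <⇒≢)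
open import Data.List using (List; applyUpTo; upTo; length)
open import Data.List.Properties using (map-upTo; length-map; length-upTo)
open import Data.Fin using (Fin; zero; suc; toℕ; inject₁; fromℕ; splitAt; join)
open import Data.Fin.Properties using (toℕ-injective; toℕ-fromℕ; splitAt-join; join-splitAt; toℕ-inject₁; toℕ<n)
open import Data.Fin.Relation.Unary.Top using (view; ‵fromℕ; ‵inject₁; view-fromℕ; view-inject₁)
  renaming (View to TopView)
open import Data.Vec using (Vec; []; _∷_; lookup; toList; fromList; cast; init; last; initLast; _∷ʳ_)
open import Data.Vec.Properties using (∷ʳ-injective; toList-cast; toList∘fromList)
open import Data.Sum using (_⊎_; inj₁; inj₂)
open import Data.Product using (_,_; proj₁; proj₂)
open import Data.Unit using (tt)
open import Data.Empty using (⊥-elim)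
open import Function using (_∘_)
open import Function.Bundles using (_⇔_; mk⇔; Equivalence)
open import Function.Construct.Composition using (_⇔-∘_)
open import Function.Construct.Symmetry using (⇔-sym)
open import Relation.Binary.PropositionalEquality

lookup-∷ʳ-inject₁ : ∀ {X : Set} {M} (v : Vec X M) x (i : Fin M) →
                    lookup (v ∷ʳ x) (inject₁ i) ≡ lookup v i
lookup-∷ʳ-inject₁ (y ∷ v) x zero    = refl
lookup-∷ʳ-inject₁ (y ∷ v) x (suc i) = lookup-∷ʳ-inject₁ v x i

lookup-∷ʳ-fromℕ : ∀ {X : Set} {M} (v : Vec X M) x → lookup (v ∷ʳ x) (fromℕ M) ≡ x
lookup-∷ʳ-fromℕ []      x = refl
lookup-∷ʳ-fromℕ (y ∷ v) x = lookup-∷ʳ-fromℕ v x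

lookup-fromList-applyUpTo : ∀ {X : Set} (h : ℕ → X) N xs (eq : length xs ≡ N) →
                            xs ≡ applyUpTo h N → ∀ i → lookup (cast eq (fromList xs)) i ≡ h (toℕ i)
lookup-fromList-applyUpTo h (suc N) _ eq refl zero    = refl
lookup-fromList-applyUpTo h (suc N) _ eq refl (suc i) =
  lookup-fromList-applyUpTo (h ∘ suc) N _ (cong pred eq) refl i

toList-cast-fromList : ∀ {X : Set} (xs : List X) {N} (eq : length xs ≡ N) →
                       toList (cast eq (fromList xs)) ≡ xs
toList-cast-fromList xs eq = trans (toList-cast eq (fromList xs)) (toList∘fromList xs)

init-∷ʳ-last : ∀ {X : Set} {M} (v : Vec X (suc M)) → v ≡ init v ∷ʳ last v
init-∷ʳ-last v = proj₂ (proj₂ (initLast v))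

moveLeft : ∀ {M n} → Fin M ⊎ Fin (suc n) → Fin (suc M) ⊎ Fin n
moveLeft (inj₁ j)       = inj₁ (inject₁ j)
moveLeft (inj₂ zero)    = inj₁ (fromℕ _)
moveLeft (inj₂ (suc b)) = inj₂ b

moveRightTop : ∀ {M n} {i : Fin (suc M)} → TopView i → Fin M ⊎ Fin (suc n)
moveRightTop ‵fromℕ       = inj₂ zero
moveRightTop (‵inject₁ j) = inj₁ j

moveRight : ∀ {M n} → Fin (suc M) ⊎ Fin n → Fin M ⊎ Fin (suc n)
moveRight (inj₁ i) = moveRightTop (view i)
moveRight (inj₂ b) = inj₂ (suc b)

moveLeft-moveRight : ∀ {M n} (x : Fin (suc M) ⊎ Fin n) → moveLeft (moveRight x) ≡ x
moveLeft-moveRight (inj₁ i) with view i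
... | ‵fromℕ = refl
... | ‵inject₁ _ = refl
moveLeft-moveRight (inj₂ b) = refl

moveRight-moveLeft : ∀ {M n} (y : Fin M ⊎ Fin (suc n)) → moveRight (moveLeft y) ≡ y
moveRight-moveLeft (inj₁ j) rewrite view-inject₁ j = refl
moveRight-moveLeft {M} (inj₂ zero) rewrite view-fromℕ M = refl
moveRight-moveLeft (inj₂ (suc b)) = refl

module LastPointShift (L : Lang) where
  open Lang L
  open WithLang L

  record Iso {S S' : Set} (A : Str S) (B : Str S') : Set where
    field
      to      : S → S'
      from    : S' → S
      from-to : ∀ x → from (to x) ≡ x
      to-from : ∀ y → to (from y) ≡ y
      to-U    : ∀ x → U B (to x) ≡ U A x
      to-R    : ∀ x y → x ≢ y → R B (to x) (to y) ≡ R A x y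

    to-injective : ∀ {x y} → to x ≡ to y → x ≡ y
    to-injective {x} {y} e = trans (sym (from-to x)) (trans (cong from e) (from-to y))

    to-Emb : Emb A B to
    to-Emb = to-injective , to-U , to-R

  Iso-sym : ∀ {S S'} {A : Str S} {B : Str S'} → Iso A B → Iso B A
  Iso-sym {A = A} {B} i = record
    { to = from ; from = to ; from-to = to-from ; to-from = from-to
    ; to-U = λ y → trans (sym (to-U (from y))) (cong (U B) (to-from y))
    ; to-R = λ x y x≢y →
        trans (sym (to-R (from x) (from y) (λ e → x≢y (trans (sym (to-from x)) (trans (cong to e) (to-from y))))))
              (cong₂ (R B) (to-from x) (to-from y))
    }
    where open Iso i

  Iso-trans : ∀ {S S' S''} {A : Str S} {B : Str S'} {C : Str S''} → Iso A B → Iso B C → Iso A C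
  Iso-trans i j = record
    { to = J.to ∘ I.to ; from = I.from ∘ J.from
    ; from-to = λ x → trans (cong I.from (J.from-to (I.to x))) (I.from-to x)
    ; to-from = λ y → trans (cong J.to (I.to-from (J.from y))) (J.to-from y)
    ; to-U = λ x → trans (J.to-U (I.to x)) (I.to-U x)
    ; to-R = λ x y x≢y → trans (J.to-R (I.to x) (I.to y) (x≢y ∘ I.to-injective)) (I.to-R x y x≢y)
    }
    where module I = Iso i
          module J = Iso j

  pull-Iso : ∀ {S S' : Set} (h : S' → S) (k : S → S') → (∀ x → k (h x) ≡ x) → (∀ y → h (k y) ≡ y) →
             (G : Str S) → Iso (pull h G) G
  pull-Iso h k kh hk G = record
    { to = h ; from = k ; from-to = kh ; to-from = hk ; to-U = λ _ → refl ; to-R = λ _ _ _ → refl }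

  Iso-IsLStr : ∀ {S S'} {A : Str S} {B : Str S'} → IsLStr A → Iso A B → IsLStr B
  Iso-IsLStr lA i a b a≢b =
    trans (sym (to-R b a (a≢b ∘ sym)))
          (trans (lA (to a) (to b) (a≢b ∘ to-injective)) (cong Flip (to-R a b a≢b)))
    where open Iso (Iso-sym i)

  Iso-𝒦 : (𝒦 : FinClass) → IsFreeFraisse 𝒦 → ∀ {a b} {X : FinStr a} {Y : FinStr b} →
          IsLStr X → Iso X Y → 𝒦 X ⇔ 𝒦 Y
  Iso-𝒦 𝒦 FF {X = X} {Y} lX i = mk⇔
    (IsFreeFraisse.hereditary FF Y X (Iso.to (Iso-sym i)) (Iso-IsLStr lX i) (Iso.to-Emb (Iso-sym i)))
    (IsFreeFraisse.hereditary FF X Y (Iso.to i) lX (Iso.to-Emb i))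

  addPoint : ∀ {n} → FinStr n → Sym → (Fin n → Sym) → FinStr (suc n)
  addPoint {n} B u ℓ = record { U = U' ; R = R' }
    where
    U' : Fin (suc n) → Sym
    U' zero    = u
    U' (suc b) = U B b
    R' : Fin (suc n) → Fin (suc n) → Sym
    R' zero    zero    = zero
    R' zero    (suc b) = ℓ b
    R' (suc b) zero    = Flip (ℓ b)
    R' (suc a) (suc b) = R B a b

  addPoint-IsLStr : ∀ {n} (B : FinStr n) u ℓ → IsLStr B → IsLStr (addPoint B u ℓ)
  addPoint-IsLStr B u ℓ lB zero    zero    ne = ⊥-elim (ne refl)
  addPoint-IsLStr B u ℓ lB zero    (suc b) ne = refl
  addPoint-IsLStr B u ℓ lB (suc b) zero    ne = sym (Flip-inv _)
  addPoint-IsLStr B u ℓ lB (suc a) (suc b) ne = lB a b (ne ∘ cong suc)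

  FlipBelow : Str ℕ → ℕ → Set
  FlipBelow S m = ∀ a b → a < m → b < m → a ≢ b → R S b a ≡ Flip (R S a b)

  glue-IsLStr : ∀ (S : Str ℕ) m {n} (B : FinStr n) (χ : Fin n → Vec Sym m) →
                FlipBelow S m → IsLStr B → IsLStr (glue S m B χ)
  glue-IsLStr S m B χ SF lB (inj₁ i) (inj₁ j) ne =
    SF (toℕ i) (toℕ j) (toℕ<n i) (toℕ<n j) (ne ∘ cong inj₁ ∘ toℕ-injective)
  glue-IsLStr S m B χ SF lB (inj₁ i) (inj₂ b) ne = refl
  glue-IsLStr S m B χ SF lB (inj₂ b) (inj₁ i) ne = sym (Flip-inv _)
  glue-IsLStr S m B χ SF lB (inj₂ a) (inj₂ b) ne = lB a b (ne ∘ cong inj₂)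

  glueFin-Iso : ∀ (S : Str ℕ) m {n} (B : FinStr n) (χ : Fin n → Vec Sym m) →
                Iso (glueFin S m B χ) (glue S m B χ)
  glueFin-Iso S m {n} B χ = pull-Iso (splitAt m) (join m n) (join-splitAt m n) (splitAt-join m n) (glue S m B χ)

  IsCode : Str ℕ → (M : ℕ) → Vec Sym M → Set
  IsCode S M w = ∀ i → lookup w i ≡ R S (toℕ i) M

  ctc-IsCode : ∀ (S : Str ℕ) M xs (eq : length xs ≡ M) → xs ≡ ctc S M → IsCode S M (cast eq (fromList xs))
  ctc-IsCode S M xs eq xs≡c =
    lookup-fromList-applyUpTo (λ j → R S j M) M xs eq (trans xs≡c (map-upTo (λ j → R S j M) M))

  shift-Iso : ∀ (S : Str ℕ) M {n} (B : FinStr n) (χ : Fin n → Vec Sym (suc M))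
              (ψ : Fin (suc n) → Vec Sym M) (u : Sym) (ℓ : Fin n → Sym) → FlipBelow S (suc M) →
              u ≡ U S M → IsCode S M (ψ zero) → (∀ b → χ b ≡ ψ (suc b) ∷ʳ ℓ b) →
              Iso (glue S M (addPoint B u ℓ) ψ) (glue S (suc M) B χ)
  shift-Iso S M B χ ψ u ℓ SF u≡ code χ≡ = record
    { to = moveLeft ; from = moveRight ; from-to = moveRight-moveLeft ; to-from = moveLeft-moveRight
    ; to-U = to-U ; to-R = to-R }
    where
    χ-inner : ∀ b i → lookup (χ b) (inject₁ i) ≡ lookup (ψ (suc b)) i
    χ-inner b i = trans (cong (λ v → lookup v (inject₁ i)) (χ≡ b)) (lookup-∷ʳ-inject₁ (ψ (suc b)) (ℓ b) i)
    χ-top : ∀ b → lookup (χ b) (fromℕ M) ≡ ℓ b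
    χ-top b = trans (cong (λ v → lookup v (fromℕ M)) (χ≡ b)) (lookup-∷ʳ-fromℕ (ψ (suc b)) (ℓ b))
    to-U : ∀ y → _
    to-U (inj₁ j)       = cong (U S) (toℕ-inject₁ j)
    to-U (inj₂ zero)    = trans (cong (U S) (toℕ-fromℕ M)) (sym u≡)
    to-U (inj₂ (suc b)) = refl
    to-R : ∀ x y → x ≢ y → _
    to-R (inj₁ i)       (inj₁ j)       ne = cong₂ (R S) (toℕ-inject₁ i) (toℕ-inject₁ j)
    to-R (inj₁ i)       (inj₂ zero)    ne = trans (cong₂ (R S) (toℕ-inject₁ i) (toℕ-fromℕ M)) (sym (code i))
    to-R (inj₁ i)       (inj₂ (suc b)) ne = χ-inner b i
    to-R (inj₂ zero)    (inj₁ i)       ne =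
      trans (cong₂ (R S) (toℕ-fromℕ M) (toℕ-inject₁ i))
        (trans (SF (toℕ i) M (m<n⇒m<1+n (toℕ<n i)) (n<1+n M) (<⇒≢ (toℕ<n i))) (cong Flip (sym (code i))))
    to-R (inj₂ zero)    (inj₂ zero)    ne = ⊥-elim (ne refl)
    to-R (inj₂ zero)    (inj₂ (suc b)) ne = χ-top b
    to-R (inj₂ (suc b)) (inj₁ i)       ne = cong Flip (χ-inner b i)
    to-R (inj₂ (suc b)) (inj₂ zero)    ne = cong Flip (χ-top b)
    to-R (inj₂ (suc a)) (inj₂ (suc b)) ne = refl

  shift-𝒞 : (𝒦 : FinClass) → IsFreeFraisse 𝒦 → ∀ (S : Str ℕ) M {n} (B : FinStr n)
            (χ : Fin n → Vec Sym (suc M)) (ψ : Fin (suc n) → Vec Sym M) (u : Sym) (ℓ : Fin n → Sym) →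
            FlipBelow S (suc M) → IsLStr B →
            u ≡ U S M → IsCode S M (ψ zero) → (∀ b → χ b ≡ ψ (suc b) ∷ʳ ℓ b) →
            𝒞 𝒦 S (suc M) B χ ⇔ 𝒞 𝒦 S M (addPoint B u ℓ) ψ
  shift-𝒞 𝒦 FF S M B χ ψ u ℓ SF lB u≡ code χ≡ = Iso-𝒦 𝒦 FF lX X≅Y
    where
    X≅Y = Iso-trans (glueFin-Iso S (suc M) B χ)
            (Iso-trans (Iso-sym (shift-Iso S M B χ ψ u ℓ SF u≡ code χ≡))
                       (Iso-sym (glueFin-Iso S M (addPoint B u ℓ) ψ)))
    lX = Iso-IsLStr (glue-IsLStr S (suc M) B χ SF lB) (Iso-sym (glueFin-Iso S (suc M) B χ))

  extend-injective : ∀ {p N} (g : Vec Sym p → Vec Sym N) → (∀ {v w} → g v ≡ g w → v ≡ w) →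
                     ∀ {v w : Vec Sym (suc p)} → g (init v) ∷ʳ last v ≡ g (init w) ∷ʳ last w → v ≡ w
  extend-injective g g-inj {v} {w} eq with ∷ʳ-injective (g (init v)) (g (init w)) eq
  ... | init≡ , last≡ = begin
    v                      ≡⟨ init-∷ʳ-last v ⟩
    init v ∷ʳ last v       ≡⟨ cong₂ _∷ʳ_ (g-inj init≡) last≡ ⟩
    init w ∷ʳ last w       ≡⟨ init-∷ʳ-last w ⟨
    w                      ∎
    where open ≡-Reasoning

  enum-FlipBelow : (A : EnumStr) → IsLStr (asStr A) → ∀ m → m ≤ᶜ card A → FlipBelow (str A) m
  enum-FlipBelow A lA m m≤|A| a b a<m b<m a≢b =
    lA (a , inDom (card A) a<m m≤|A|) (b , inDom (card A) b<m m≤|A|) (a≢b ∘ cong proj₁)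
    where
    inDom : ∀ c {a} → a < m → m ≤ᶜ c → a <ᶜ c
    inDom (fin N) a<m m≤N = <-≤-trans a<m m≤N
    inDom omega   _   _   = tt

proposition2p6 : (L : Lang) → let open WithLang L in
    (𝒦 : FinClass) → IsFreeFraisse 𝒦 →
    (K : Str ℕ) → IsFraisseLimit 𝒦 K → LeftDense 𝒦 K →
    (A : EnumStr) → IsLStr (asStr A) → AgeSub 𝒦 A →
    (p : ℕ) → suc p ≤ᶜ card A →
    (f : T → T) (f̃ : ℕ → ℕ) (e : IsAEmb 𝒦 (str A) K (suc p) f f̃) →
    AgeMap (𝒞 𝒦 (str A) (suc p)) (𝒞 𝒦 K (suc (f̃ p)))
    (f'Level f p (f̃ p) (IsAEmb.level e p (n<1+n p)))
proposition2p6 L 𝒦 FF K FL _ A lA _ p p≤|A| f f̃ e =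
  extend-injective g (proj₁ aged-p) , λ B φ lB → let open Equivalence (transfer B φ lB) in to , from
  where
  open WithLang L
  open LastPointShift L
  N   = f̃ p
  lev = IsAEmb.level e p (n<1+n p)
  g   = restrictLevel f p N lev
  aged-p = IsAEmb.aged e p (n<1+n p)
  length-cᴬ : length (ctc (str A) p) ≡ p
  length-cᴬ = trans (length-map _ (upTo p)) (length-upTo p)
  w : Vec Sym p
  w = cast length-cᴬ (fromList (ctc (str A) p))
  w-code : IsCode (str A) p w
  w-code = ctc-IsCode (str A) p _ length-cᴬ refl
  gw-code : IsCode K N (g w)
  gw-code = ctc-IsCode K N _ (lev w)
    (trans (cong f (toList-cast-fromList (ctc (str A) p) length-cᴬ)) (IsAEmb.codec e p (n<1+n p)))
  -- 𝒞^A(p+1) ∋ (B, φ)  ⇔  𝒞^A(p) ∋ (B', ψ)  ⇔  𝒞(N) ∋ (B', g ∘ ψ)  ⇔  𝒞(N+1) ∋ (B, f' ∘ φ)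
  transfer : ∀ {n} (B : FinStr n) (φ : Fin n → Vec Sym (suc p)) → IsLStr B →
             𝒞 𝒦 (str A) (suc p) B φ ⇔ 𝒞 𝒦 K (suc N) B (f'Level f p N lev ∘ φ)
  transfer {n} B φ lB = ⇔-sym shift-K ⇔-∘ (aged-B' ⇔-∘ shift-A)
    where
    ψ : Fin (suc n) → Vec Sym p
    ψ zero    = w
    ψ (suc b) = init (φ b)
    u = U (str A) p
    ℓ = last ∘ φ
    shift-A = shift-𝒞 𝒦 FF (str A) p B φ ψ u ℓ (enum-FlipBelow A lA (suc p) p≤|A|) lB
                refl w-code (λ b → init-∷ʳ-last (φ b))
    aged-B' = let ages = proj₂ aged-p (addPoint B u ℓ) ψ (addPoint-IsLStr B u ℓ lB)
              in mk⇔ (proj₁ ages) (proj₂ ages)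
    shift-K = shift-𝒞 𝒦 FF K N B (f'Level f p N lev ∘ φ) (g ∘ ψ) u ℓ (λ a b _ _ → IsFraisseLimit.lstr FL a b) lB
                (IsAEmb.codeu e p (n<1+n p)) gw-code (λ _ → refl)
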